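{- Let $0\le j<\ell$ and let $C^j_1,\dots,C^j_s$ be distinct components of $C\langle\{\phi(1),\dots,\phi(j)\}\rangle$ all contained in a single component $C^{j+1}$ of $C\langle\{\phi(1),\dots,\phi(j+1)\}\rangle$, where $1<s\le g_j/g_{j+1}$. If $j<\ell-1$ or $s<g_j/g_{j+1}$, then $$\sum_{\substack{1\le i_1,i_2\le s\\ i_1\ne i_2}}x\big(\delta^+(C^j_{i_1},C^j_{i_2})\big)\le s-1.$$
   Context: Setting: $n\ge3$, $V=[n]$ with arithmetic mod $n$, $d=\lfloor n/2\rfloor$; a symmetric circulant instance with stripe costs $c_1,\dots,c_d$. $\phi$ is a permutation of $[d]$ with $c_{\phi(1)}\le\dots\le c_{\phi(d)}$; $g_0=n$, $g_i=\gcd(\phi(i),g_{i-1})$; $\ell=\min\{i:g_i=1\}$; standing assumption $g_0>g_1>\dots>g_\ell=1$. For $T\subseteq[d]$, $C\langle T\rangle$ is the graph on $V$ containing exactly the edges $\{v,v+k\}$, $k\in T$; the components of $C\langle\{\phi(1),\dots,\phi(i)\}\rangle$ are the residue classes mod $g_i$. The graph is viewed as directed: for each $v$ and $k\in[d]$ a directed edge $(v,v+k)$ of length $k$ (for $k=n/2$ both $(v,v+n/2)$ and $(v+n/2,v)$). The weight $x$ of a directed edge of length $\phi(i)$ is $(g_{i-1}-g_i)/n$ if $i<\ell$, $g_{\ell-1}/n$ if $i=\ell$, $0$ if $i>\ell$. For $A,B\subseteq V$, $\delta^+(A,B)$ is the set of directed edges $(u,v)$ with $u\in A$, $v\in B$,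 and $x(F)=\sum_{e\in F}x_e$. -}

module Defs where

open import Data.Nat using (ℕ; zero; suc; _+_; _*_; _∸_; _≤_; _<_; NonZero; _≡ᵇ_; _<ᵇ_; ≢-nonZero; ≢-nonZero⁻¹)
open import Data.Nat.DivMod using (_/_; _%_)
open import Data.Nat.GCD using (gcd; gcd[m,n]≢0)
open import Data.Bool using (Bool; true; false; if_then_else_; _∧_)
open import Data.Integer using (+_)
open import Data.Rational using (ℚ; 0ℚ) renaming (_+_ to _+ℚ_; _/_ to _/ℚ_)
open import Data.Sum using (inj₂)
open import Data.Product using (_×_)
open import Relation.Binary.PropositionalEquality using (_≡_; _≢_)

sumℚ : ℕ → (ℕ → ℚ) → ℚ
sumℚ zero    f = 0ℚ
sumℚ (suc m) f = sumℚ m f +ℚ f m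

sumℚ₁ : ℕ → (ℕ → ℚ) → ℚ
sumℚ₁ m f = sumℚ m (λ i → f (suc i))

half : ℕ → ℕ
half n = n / 2

-- φ is a permutation of [d] = {1,…,d} (φ given as a function ℕ → ℕ; only its
-- values on [d] matter)
IsPermOf : ℕ → (ℕ → ℕ) → Set
IsPermOf d φ =
  (∀ i → 1 ≤ i → i ≤ d → (1 ≤ φ i × φ i ≤ d)) ×
  (∀ i i' → 1 ≤ i → i ≤ d → 1 ≤ i' → i' ≤ d → φ i ≡ φ i' → i ≡ i')

gseq : ℕ → (ℕ → ℕ) → ℕ → ℕ
gseq n φ zero    = n
gseq n φ (suc i) = gcd (φ (suc i)) (gseq n φ i)

gseq≢0 : ∀ n .{{_ : NonZero n}} φ i → gseq n φ i ≢ 0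
gseq≢0 n φ zero    = ≢-nonZero⁻¹ n
gseq≢0 n φ (suc i) = gcd[m,n]≢0 (φ (suc i)) (gseq n φ i) (inj₂ (gseq≢0 n φ i))

gseq-nonZero : ∀ n .{{_ : NonZero n}} φ i → NonZero (gseq n φ i)
gseq-nonZero n φ i = ≢-nonZero (gseq≢0 n φ i)

modg : (n : ℕ) → .{{NonZero n}} → (ℕ → ℕ) → ℕ → ℕ → ℕ
modg n φ i v = _%_ v (gseq n φ i) {{gseq-nonZero n φ i}}

gratio : (n : ℕ) → .{{NonZero n}} → (ℕ → ℕ) → ℕ → ℕ
gratio n φ j = _/_ (gseq n φ j) (gseq n φ (suc j)) {{gseq-nonZero n φ (suc j)}}

-- ℓ is min{ i : gᵢ = 1 }, together with the standing assumption
-- g₀ > g₁ > … > g_ℓ = 1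
IsEll : ℕ → (ℕ → ℕ) → ℕ → Set
IsEll n φ ℓ =
  (gseq n φ ℓ ≡ 1) ×
  (∀ i → i < ℓ → gseq n φ i ≢ 1) ×
  (∀ i → i < ℓ → gseq n φ (suc i) < gseq n φ i)

-- numerator (times n) of the weight of a directed edge of length φ(i), i ∈ [d]:
--   (g_{i-1} - g_i) if i < ℓ,  g_{ℓ-1} if i = ℓ,  0 if i > ℓ
wnum : ℕ → (ℕ → ℕ) → ℕ → ℕ → ℕ
wnum n φ ℓ zero    = 0
wnum n φ ℓ (suc i) =
  if suc i <ᵇ ℓ then gseq n φ i ∸ gseq n φ (suc i)
  else if suc i ≡ᵇ ℓ then gseq n φ i
  else 0

-- weight x of a directed edge of length k ∈ [d]: the weight assigned to φ(i)
-- for the (unique) i ∈ [d] with φ(i) = k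
xlen : (n : ℕ) → .{{NonZero n}} → (ℕ → ℕ) → ℕ → ℕ → ℚ
xlen n φ ℓ k =
  sumℚ₁ (half n) (λ i → if φ i ≡ᵇ k then (+ wnum n φ ℓ i) /ℚ n else 0ℚ)

-- x(δ⁺(A,B)) where A, B ⊆ V = {0,…,n-1} are given by Boolean membership tests;
-- the directed edges are (v, v+k mod n) for v ∈ V, k ∈ [d]
xδ : (n : ℕ) → .{{NonZero n}} → (ℕ → ℕ) → ℕ → (ℕ → Bool) → (ℕ → Bool) → ℚ
xδ n φ ℓ A B =
  sumℚ n (λ v → sumℚ₁ (half n) (λ k →
    if A v ∧ B ((v + k) % n) then xlen n φ ℓ k else 0ℚ))

-- the residue class { v ∈ V : v ≡ r (mod gᵢ) } (a component of C⟨{φ(1),…,φ(i)}⟩)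
resClass : (n : ℕ) → .{{NonZero n}} → (ℕ → ℕ) → ℕ → ℕ → ℕ → Bool
resClass n φ i r v = modg n φ i v ≡ᵇ r

{-# OPTIONS --safe #-}
-- All weights are multiples of 1/n, so after scaling by n the argument runs in ℕ.
-- An edge between two distinct classes mod g_j inside one class mod g_{j+1} has a length
-- divisible by g_{j+1} but not by g_j; among the stripes of positive weight only φ(j+1) is
-- such a length. So every such edge goes from the class of r to the class of r + φ(j+1)
-- (mod g_j), and the sum is at most P · w / g_j, where w = n · x(φ(j+1)) ≤ g_j and P ≤ s
-- counts the pairs (i₁, i₂) with r_{i₂} ≡ r_{i₁} + φ(j+1). If P < s we are done. If P = s,
-- the residues r_i are closed under adding φ(j+1), so they contain a whole orbit, which has
-- g_j / g_{j+1} elements. Then s = g_j / g_{j+1}, the hypothesis forces j + 1 < ℓ, hence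
-- w = g_j − g_{j+1} and s · w / g_j = s − 1.
module Submission where

open import Defs
open import Data.Bool using (Bool; true; false; if_then_else_; T; _∧_)
open import Data.Empty using (⊥-elim)
open import Data.Fin using (Fin; toℕ; fromℕ<)
import Data.Fin.Properties as Fin
open import Data.Integer using (+_; +≤+) renaming (_≤_ to _≤ℤ_; _*_ to _*ℤ_; _+_ to _+ℤ_)
import Data.Integer.Properties as ℤ
import Data.Integer.Tactic.RingSolver as ℤ-Solver
open import Data.Nat
open import Data.Nat.Properties
open import Data.Nat.DivMod
open import Data.Nat.Divisibility
open import Data.Nat.GCD
open import Data.Nat.Coprimality using (coprime-/gcd; coprime-divisor) renaming (sym to coprime-sym)
open import Data.Nat.Tactic.RingSolver using (solve-∀)
open import Data.Product using (_×_; _,_; ∃-syntax; proj₁; proj₂)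
open import Data.Rational using (ℚ; 0ℚ; toℚᵘ) renaming (_≤_ to _≤ℚ_; _/_ to _/ℚ_; _+_ to _+ℚ_)
import Data.Rational.Properties as ℚ
open import Data.Rational.Unnormalised using (mkℚᵘ; *≡*; *≤*; _≃_) renaming (_+_ to _+ᵘ_)
import Data.Rational.Unnormalised.Properties as ℚᵘ
open import Data.Sum using (_⊎_; inj₁; inj₂; [_,_])
open import Function using (_∘_; id)
open import Relation.Binary.PropositionalEquality
  using (_≡_; _≢_; refl; sym; trans; cong; cong₂; subst; subst₂; module ≡-Reasoning)
open import Relation.Binary.Definitions using (tri<; tri≈; tri>)
open import Relation.Nullary using (¬_; yes; no)
open import Relation.Nullary.Decidable using (proof)
open import Relation.Nullary.Reflects using (Reflects; ofʸ; ofⁿ)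

≡ᵇ-reflects : ∀ m n → Reflects (m ≡ n) (m ≡ᵇ n)
≡ᵇ-reflects m n = proof (m ≟ n)

if-≤-if-if : ∀ b c x → (T b → T c) → (if b then x else 0) ≤ (if b then (if c then x else 0) else 0)
if-≤-if-if true  true  x _   = ≤-refl
if-≤-if-if true  false x b⇒c = ⊥-elim (b⇒c _)
if-≤-if-if false c     x _   = z≤n

if-positive⇒T : ∀ b x → 0 < (if b then x else 0) → T b
if-positive⇒T true  x _  = _
if-positive⇒T false x ()

≡ᵇ-unique : ∀ {x y} c → T (x ≡ᵇ c) → T (y ≡ᵇ c) → x ≡ y
≡ᵇ-unique {x} {y} c x≡c y≡c = trans (≡ᵇ⇒≡ x c x≡c) (sym (≡ᵇ⇒≡ y c y≡c))

sumℕ : ℕ → (ℕ → ℕ) → ℕ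
sumℕ zero    f = 0
sumℕ (suc m) f = sumℕ m f + f m

sumℕ-cong : ∀ m {f g} → (∀ {i} → i < m → f i ≡ g i) → sumℕ m f ≡ sumℕ m g
sumℕ-cong zero    f≡g = refl
sumℕ-cong (suc m) f≡g = cong₂ _+_ (sumℕ-cong m (f≡g ∘ m<n⇒m<1+n)) (f≡g ≤-refl)

sumℕ-mono-≤ : ∀ m {f g} → (∀ {i} → i < m → f i ≤ g i) → sumℕ m f ≤ sumℕ m g
sumℕ-mono-≤ zero    f≤g = z≤n
sumℕ-mono-≤ (suc m) f≤g = +-mono-≤ (sumℕ-mono-≤ m (f≤g ∘ m<n⇒m<1+n)) (f≤g ≤-refl)

sumℕ-zero : ∀ m {f} → (∀ {i} → i < m → f i ≡ 0) → sumℕ m f ≡ 0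
sumℕ-zero zero    f≡0 = refl
sumℕ-zero (suc m) f≡0 = cong₂ _+_ (sumℕ-zero m (f≡0 ∘ m<n⇒m<1+n)) (f≡0 ≤-refl)

sumℕ-*ʳ : ∀ m f c → sumℕ m (λ i → f i * c) ≡ sumℕ m f * c
sumℕ-*ʳ zero    f c = refl
sumℕ-*ʳ (suc m) f c = trans (cong (_+ f m * c) (sumℕ-*ʳ m f c)) (sym (*-distribʳ-+ c (sumℕ m f) (f m)))

sumℕ-+ : ∀ a b f → sumℕ (a + b) f ≡ sumℕ a f + sumℕ b (λ u → f (a + u))
sumℕ-+ a zero    f = trans (cong (λ m → sumℕ m f) (+-identityʳ a)) (sym (+-identityʳ _))
sumℕ-+ a (suc b) f = begin
  sumℕ (a + suc b) f                                ≡⟨ cong (λ m → sumℕ m f) (+-suc a b) ⟩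
  sumℕ (a + b) f + f (a + b)                        ≡⟨ cong (_+ f (a + b)) (sumℕ-+ a b f) ⟩
  sumℕ a f + sumℕ b (λ u → f (a + u)) + f (a + b)   ≡⟨ +-assoc (sumℕ a f) _ _ ⟩
  sumℕ a f + (sumℕ b (λ u → f (a + u)) + f (a + b)) ∎
  where open ≡-Reasoning

sumℕ-periodic : ∀ q g .{{_ : NonZero g}} (h : ℕ → ℕ) → sumℕ (q * g) (λ v → h (v % g)) ≡ q * sumℕ g h
sumℕ-periodic zero    g h = refl
sumℕ-periodic (suc q) g h = begin
  sumℕ (g + q * g) (λ v → h (v % g))
    ≡⟨ sumℕ-+ g (q * g) _ ⟩
  sumℕ g (λ v → h (v % g)) + sumℕ (q * g) (λ u → h ((g + u) % g))
    ≡⟨ cong₂ _+_ (sumℕ-cong g (cong h ∘ m<n⇒m%n≡m))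
                 (sumℕ-cong (q * g) (λ {u} _ → cong h (%-remove-+ˡ u ∣-refl))) ⟩
  sumℕ g h + sumℕ (q * g) (λ u → h (u % g))
    ≡⟨ cong (λ t → sumℕ g h + t) (sumℕ-periodic q g h) ⟩
  sumℕ g h + q * sumℕ g h
    ∎
  where open ≡-Reasoning

sumℕ-≤-indicator : ∀ m {f} (P : ℕ → Bool) X →
  (∀ {i i'} → i < m → i' < m → T (P i) → T (P i') → i ≡ i') →
  (∀ {i} → i < m → f i ≤ (if P i then X else 0)) →
  sumℕ m f ≤ X
sumℕ-≤-indicator zero    P X unique f≤ = z≤n
sumℕ-≤-indicator (suc m) {f} P X unique f≤ with P m in Pm | f≤ (n<1+n m)
... | false | fm≤0 = begin
  sumℕ m f + f m  ≡⟨ cong (λ t → sumℕ m f + t) (n≤0⇒n≡0 fm≤0) ⟩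
  sumℕ m f + 0    ≡⟨ +-identityʳ _ ⟩
  sumℕ m f        ≤⟨ sumℕ-≤-indicator m P X (λ i<m i'<m → unique (m<n⇒m<1+n i<m) (m<n⇒m<1+n i'<m))
                                          (f≤ ∘ m<n⇒m<1+n) ⟩
  X               ∎
  where open ≤-Reasoning
... | true  | fm≤X = subst (_≤ X) (cong (_+ f m) (sym (sumℕ-zero m fi≡0))) fm≤X
  where
  fi≡0 : ∀ {i} → i < m → f i ≡ 0
  fi≡0 {i} i<m with P i in Pi | f≤ (m<n⇒m<1+n i<m)
  ... | true  | _    = ⊥-elim (<-irrefl (unique (m<n⇒m<1+n i<m) ≤-refl (subst T (sym Pi) _) (subst T (sym Pm) _)) i<m)
  ... | false | fi≤0 = n≤0⇒n≡0 fi≤0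

sumℕ-≤-length : ∀ m {f} → (∀ {i} → i < m → f i ≤ 1) → sumℕ m f ≤ m
sumℕ-≤-length zero    f≤1 = z≤n
sumℕ-≤-length (suc m) f≤1 =
  ≤-trans (+-mono-≤ (sumℕ-≤-length m (f≤1 ∘ m<n⇒m<1+n)) (f≤1 ≤-refl)) (≤-reflexive (+-comm m 1))

sumℕ-<-or-positive : ∀ m {f} → (∀ {i} → i < m → f i ≤ 1) → sumℕ m f < m ⊎ (∀ {i} → i < m → 0 < f i)
sumℕ-<-or-positive zero    f≤1 = inj₂ λ ()
sumℕ-<-or-positive (suc m) {f} f≤1 with sumℕ-<-or-positive m (f≤1 ∘ m<n⇒m<1+n) | f m in fm
... | inj₁ sum<m | _     =
  inj₁ (<-≤-trans (+-mono-<-≤ sum<m (subst (_≤ 1) fm (f≤1 ≤-refl))) (≤-reflexive (+-comm m 1)))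
... | inj₂ _     | zero  =
  inj₁ (s≤s (subst (_≤ m) (sym (+-identityʳ _)) (sumℕ-≤-length m (f≤1 ∘ m<n⇒m<1+n))))
... | inj₂ pos   | suc _ =
  inj₂ λ i<1+m → [ pos , (λ { refl → subst (0 <_) (sym fm) z<s }) ] (m≤n⇒m<n∨m≡n (≤-pred i<1+m))

∃-positive-summand : ∀ m {f} → 0 < sumℕ m f → ∃[ i ] i < m × 0 < f i
∃-positive-summand (suc m) {f} sum>0 with f m in fm
... | suc _ = m , ≤-refl , subst (0 <_) (sym fm) z<s
... | zero  with ∃-positive-summand m (subst (0 <_) (+-identityʳ _) sum>0)
...   | i , i<m , fi>0 = i , m<n⇒m<1+n i<m , fi>0

m%n≡r⇒[m+o]%n≡[r+o]%n : ∀ {m r} o n .{{_ : NonZero n}} → m % n ≡ r → (m + o) % n ≡ (r + o) % n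
m%n≡r⇒[m+o]%n≡[r+o]%n {m} {r} o n m%n≡r = begin
  (m + o) % n              ≡⟨ %-distribˡ-+ m o n ⟩
  (m % n + o % n) % n      ≡⟨ cong (λ x → (x + o % n) % n) (m%n%n≡m%n m n) ⟨
  (m % n % n + o % n) % n  ≡⟨ %-distribˡ-+ (m % n) o n ⟨
  (m % n + o) % n          ≡⟨ cong (λ x → (x + o) % n) m%n≡r ⟩
  (r + o) % n              ∎
  where open ≡-Reasoning

[m+o]%n≡m%n⇒n∣o : ∀ m o n .{{_ : NonZero n}} → (m + o) % n ≡ m % n → n ∣ o
[m+o]%n≡m%n⇒n∣o m o n eq = ∣m+n∣m⇒∣n (subst (n ∣_) (sym quotients) (n∣m*n ((m + o) / n))) (n∣m*n (m / n))
  where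
  open ≡-Reasoning
  quotients : m / n * n + o ≡ (m + o) / n * n
  quotients = +-cancelˡ-≡ (m % n) _ _ (begin
    m % n + (m / n * n + o)  ≡⟨ +-assoc (m % n) _ o ⟨
    m % n + m / n * n + o    ≡⟨ cong (_+ o) (m≡m%n+[m/n]*n m n) ⟨
    m + o                    ≡⟨ m≡m%n+[m/n]*n (m + o) n ⟩
    (m + o) % n + (m + o) / n * n ≡⟨ cong (_+ (m + o) / n * n) eq ⟩
    m % n + (m + o) / n * n  ∎)

n∣o*m⇒n/gcd[m,n]∣o : ∀ m n o .{{_ : NonZero (gcd m n)}} → n ∣ o * m → n / gcd m n ∣ o
n∣o*m⇒n/gcd[m,n]∣o m n o n∣om =
  coprime-divisor (coprime-sym (coprime-/gcd m n)) (subst (n / gcd m n ∣_) (*-comm o (m / gcd m n)) cancelled)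
  where
  h = gcd m n
  cancelled : n / h ∣ o * (m / h)
  cancelled = *-cancelʳ-∣ h (subst₂ _∣_ (sym (m/n*n≡m (gcd[m,n]∣n m n)))
    (trans (cong (o *_) (sym (m/n*n≡m (gcd[m,n]∣m m n)))) (sym (*-assoc o (m / h) h))) n∣om)

orbit-injective : ∀ a g x .{{_ : NonZero g}} .{{_ : NonZero (gcd a g)}} {t₁ t₂} →
  t₁ < t₂ → t₂ < g / gcd a g → (x + t₁ * a) % g ≢ (x + t₂ * a) % g
orbit-injective a g x {t₁} {t₂} t₁<t₂ t₂<M eq =
  <⇒≱ (≤-<-trans (m∸n≤m t₂ t₁) t₂<M) (∣⇒≤ {{>-nonZero (m<n⇒0<n∸m t₁<t₂)}} M∣t₂∸t₁)
  where
  step : x + t₁ * a + (t₂ ∸ t₁) * a ≡ x + t₂ * a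
  step = trans (+-assoc x _ _) (cong (λ y → x + y)
           (trans (sym (*-distribʳ-+ a t₁ (t₂ ∸ t₁))) (cong (_* a) (m+[n∸m]≡n (<⇒≤ t₁<t₂)))))
  M∣t₂∸t₁ : g / gcd a g ∣ t₂ ∸ t₁
  M∣t₂∸t₁ = n∣o*m⇒n/gcd[m,n]∣o a g (t₂ ∸ t₁)
              ([m+o]%n≡m%n⇒n∣o (x + t₁ * a) _ g (trans (cong (_% g) step) (sym eq)))

+-closed⇒g/gcd[a,g]≤s : ∀ a g .{{_ : NonZero g}} .{{_ : NonZero (gcd a g)}} s (r : ℕ → ℕ) → 0 < s → r 0 < g →
  (∀ {i} → i < s → ∃[ i' ] i' < s × r i' ≡ (r i + a) % g) → g / gcd a g ≤ s
+-closed⇒g/gcd[a,g]≤s a g s r s>0 r₀<g closed = ≮⇒≥ λ s<M →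
  let t₁ , t₂ , t₁<t₂ , same = Fin.pigeonhole s<M index
  in orbit-injective a g (r 0) t₁<t₂ (Fin.toℕ<n t₂) (begin
    (r 0 + toℕ t₁ * a) % g  ≡⟨ orbit-hits t₁ ⟨
    r (proj₁ (orbit (toℕ t₁))) ≡⟨ cong r (index-injective t₁ t₂ same) ⟩
    r (proj₁ (orbit (toℕ t₂))) ≡⟨ orbit-hits t₂ ⟩
    (r 0 + toℕ t₂ * a) % g  ∎)
  where
  open ≡-Reasoning
  orbit : ∀ t → ∃[ i ] i < s × r i ≡ (r 0 + t * a) % g
  orbit zero = 0 , s>0 , sym (trans (cong (_% g) (+-identityʳ (r 0))) (m<n⇒m%n≡m r₀<g))
  orbit (suc t) with orbit t
  ... | i , i<s , rᵢ≡ with closed i<s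
  ... | i' , i'<s , rᵢ'≡ = i' , i'<s , (begin
    r i'                           ≡⟨ rᵢ'≡ ⟩
    (r i + a) % g                  ≡⟨ m%n≡r⇒[m+o]%n≡[r+o]%n a g (sym rᵢ≡) ⟨
    (r 0 + t * a + a) % g          ≡⟨ cong (_% g) (trans (+-assoc (r 0) _ a) (cong (λ y → r 0 + y) (+-comm (t * a) a))) ⟩
    (r 0 + suc t * a) % g          ∎)
  index : Fin (g / gcd a g) → Fin s
  index t = fromℕ< (proj₁ (proj₂ (orbit (toℕ t))))
  orbit-hits : ∀ t → r (proj₁ (orbit (toℕ t))) ≡ (r 0 + toℕ t * a) % g
  orbit-hits t = proj₂ (proj₂ (orbit (toℕ t)))
  index-injective : ∀ t₁ t₂ → index t₁ ≡ index t₂ → proj₁ (orbit (toℕ t₁)) ≡ proj₁ (orbit (toℕ t₂))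
  index-injective t₁ t₂ eq = trans (sym (Fin.toℕ-fromℕ< _)) (trans (cong toℕ eq) (Fin.toℕ-fromℕ< _))

toℚᵘ-/suc : ∀ m a → toℚᵘ ((+ a) /ℚ suc m) ≃ mkℚᵘ (+ a) m
toℚᵘ-/suc m a = ℚ.toℚᵘ-fromℚᵘ (mkℚᵘ (+ a) m)

/suc-+ : ∀ m a b → (+ a) /ℚ suc m +ℚ (+ b) /ℚ suc m ≡ (+ (a + b)) /ℚ suc m
/suc-+ m a b = ℚ.toℚᵘ-injective (begin
  toℚᵘ ((+ a) /ℚ suc m +ℚ (+ b) /ℚ suc m)         ≈⟨ ℚ.toℚᵘ-homo-+ ((+ a) /ℚ suc m) ((+ b) /ℚ suc m) ⟩
  toℚᵘ ((+ a) /ℚ suc m) +ᵘ toℚᵘ ((+ b) /ℚ suc m)  ≈⟨ ℚᵘ.+-cong (toℚᵘ-/suc m a) (toℚᵘ-/suc m b) ⟩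
  mkℚᵘ (+ a) m +ᵘ mkℚᵘ (+ b) m                    ≈⟨ *≡* cross ⟩
  mkℚᵘ (+ (a + b)) m                              ≈⟨ toℚᵘ-/suc m (a + b) ⟨
  toℚᵘ ((+ (a + b)) /ℚ suc m)                     ∎)
  where
  open ℚᵘ.≃-Reasoning
  distrib : ∀ x y z → (x *ℤ z +ℤ y *ℤ z) *ℤ z ≡ (x +ℤ y) *ℤ (z *ℤ z)
  distrib = ℤ-Solver.solve-∀
  cross : (+ a *ℤ + suc m +ℤ + b *ℤ + suc m) *ℤ + suc m ≡ + (a + b) *ℤ + (suc m * suc m)
  cross = trans (distrib (+ a) (+ b) (+ suc m)) (sym (cong₂ _*ℤ_ (ℤ.pos-+ a b) (ℤ.pos-* (suc m) (suc m))))

/suc-≤ : ∀ m a b → a ≤ b * suc m → (+ a) /ℚ suc m ≤ℚ (+ b) /ℚ 1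
/suc-≤ m a b a≤bn = ℚ.toℚᵘ-cancel-≤
  (ℚᵘ.≤-respˡ-≃ (ℚᵘ.≃-sym (toℚᵘ-/suc m a)) (ℚᵘ.≤-respʳ-≃ (ℚᵘ.≃-sym (toℚᵘ-/suc 0 b))
    (*≤* (subst₂ _≤ℤ_ (sym (ℤ.*-identityʳ (+ a))) (ℤ.pos-* b (suc m)) (+≤+ a≤bn)))))

sumℚ-/suc : ∀ m k {f} (F : ℕ → ℕ) → (∀ {i} → i < k → f i ≡ (+ F i) /ℚ suc m) →
  sumℚ k f ≡ (+ sumℕ k F) /ℚ suc m
sumℚ-/suc m zero    F f≡F = sym (ℚ.0/n≡0 (suc m))
sumℚ-/suc m (suc k) F f≡F =
  trans (cong₂ _+ℚ_ (sumℚ-/suc m k F (f≡F ∘ m<n⇒m<1+n)) (f≡F ≤-refl)) (/suc-+ m (sumℕ k F) (F k))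

if-/suc : ∀ m b {y z} x x' → y ≡ (+ x) /ℚ suc m → z ≡ (+ x') /ℚ suc m →
  (if b then y else z) ≡ (+ (if b then x else x')) /ℚ suc m
if-/suc m true  x x' y≡ z≡ = y≡
if-/suc m false x x' y≡ z≡ = z≡

s*[c*[s*h∸h]]≡[s∸1]*[c*[s*h]] : ∀ s c h → s * (c * (s * h ∸ h)) ≡ (s ∸ 1) * (c * (s * h))
s*[c*[s*h∸h]]≡[s∸1]*[c*[s*h]] s c h = begin
  s * (c * (s * h ∸ h))        ≡⟨ cong (λ x → s * (c * (s * h ∸ x))) (*-identityˡ h) ⟨
  s * (c * (s * h ∸ 1 * h))    ≡⟨ cong (λ x → s * (c * x)) (*-distribʳ-∸ h s 1) ⟨
  s * (c * ((s ∸ 1) * h))      ≡⟨ rearrange s c (s ∸ 1) h ⟩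
  (s ∸ 1) * (c * (s * h))      ∎
  where
  open ≡-Reasoning
  rearrange : ∀ s c t h → s * (c * (t * h)) ≡ t * (c * (s * h))
  rearrange = solve-∀

module Circulant (n : ℕ) .{{_ : NonZero n}} (φ : ℕ → ℕ) (ℓ : ℕ) where

  private
    g : ℕ → ℕ
    g = gseq n φ

    d : ℕ
    d = half n

  gseq-antitone : ∀ {t i} → t ≤ i → g i ∣ g t
  gseq-antitone {i = zero}  z≤n   = ∣-refl
  gseq-antitone {i = suc i} t≤1+i with m≤n⇒m<n∨m≡n t≤1+i
  ... | inj₁ t<1+i = ∣-trans (gcd[m,n]∣n (φ (suc i)) (g i)) (gseq-antitone (≤-pred t<1+i))
  ... | inj₂ refl  = ∣-refl

  gseq∣n : ∀ i → g i ∣ n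
  gseq∣n i = gseq-antitone {i = i} z≤n

  gseq∣φ : ∀ {t i} → t < i → g i ∣ φ (suc t)
  gseq∣φ {t} t<i = ∣-trans (gseq-antitone t<i) (gcd[m,n]∣m (φ (suc t)) (g t))

  gseq∤φ : IsEll n φ ℓ → ∀ {i t} → i ≤ t → t < ℓ → ¬ g i ∣ φ (suc t)
  gseq∤φ (_ , _ , decreasing) {i} {t} i≤t t<ℓ gᵢ∣φ = <-irrefl stalls (decreasing t t<ℓ)
    where
    stalls : g (suc t) ≡ g t
    stalls = ∣-antisym (gcd[m,n]∣n (φ (suc t)) (g t)) (gcd-greatest (∣-trans (gseq-antitone i≤t) gᵢ∣φ) ∣-refl)

  wnum-≤ : ∀ i → wnum n φ ℓ (suc i) ≤ g i
  wnum-≤ i with suc i <ᵇ ℓ | suc i ≡ᵇ ℓ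
  ... | true  | _     = m∸n≤m (g i) (g (suc i))
  ... | false | true  = ≤-refl
  ... | false | false = z≤n

  wnum-< : ∀ {i} → suc i < ℓ → wnum n φ ℓ (suc i) ≡ g i ∸ g (suc i)
  wnum-< {i} 1+i<ℓ with suc i <ᵇ ℓ | <ᵇ-reflects-< (suc i) ℓ
  ... | true  | _         = refl
  ... | false | ofⁿ 1+i≮ℓ = ⊥-elim (1+i≮ℓ 1+i<ℓ)

  wnum-≥ : ∀ {i} → ℓ ≤ i → wnum n φ ℓ (suc i) ≡ 0
  wnum-≥ {i} ℓ≤i with suc i <ᵇ ℓ | <ᵇ-reflects-< (suc i) ℓ | suc i ≡ᵇ ℓ | ≡ᵇ-reflects (suc i) ℓ
  ... | true  | ofʸ 1+i<ℓ | _     | _         = ⊥-elim (<⇒≱ 1+i<ℓ (m≤n⇒m≤1+n ℓ≤i))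
  ... | false | _         | true  | ofʸ 1+i≡ℓ = ⊥-elim (<-irrefl refl (subst (_≤ i) (sym 1+i≡ℓ) ℓ≤i))
  ... | false | _         | false | _         = refl

  -- n · x on an edge of length k
  lengthWeight : ℕ → ℕ
  lengthWeight k = sumℕ d (λ t → if φ (suc t) ≡ᵇ k then wnum n φ ℓ (suc t) else 0)

  -- n · x(δ⁺(A, B))
  flow : (ℕ → Bool) → (ℕ → Bool) → ℕ
  flow A B = sumℕ n (λ v → sumℕ d (λ k → if A v ∧ B ((v + suc k) % n) then lengthWeight (suc k) else 0))

  module Level (ell : IsEll n φ ℓ) (j : ℕ) where

    private
      instance
        gⱼ-nonZero : NonZero (g j)
        gⱼ-nonZero = gseq-nonZero n φ j
        gⱼ₊₁-nonZero : NonZero (g (suc j))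
        gⱼ₊₁-nonZero = gseq-nonZero n φ (suc j)

    successorWeight : ℕ → ℕ → ℕ
    successorWeight r₁ r₂ = if r₂ ≡ᵇ (r₁ + φ (suc j)) % g j then wnum n φ ℓ (suc j) else 0

    crossing-length : ∀ {r₁ r₂ v k} → r₁ ≢ r₂ → r₁ % g (suc j) ≡ r₂ % g (suc j) →
      v % g j ≡ r₁ → (v + k) % g j ≡ r₂ → ¬ g j ∣ k × g (suc j) ∣ k
    crossing-length {r₁} {r₂} {v} {k} r₁≢r₂ same-parent v∈C₁ v+k∈C₂ =
      (λ gⱼ∣k → r₁≢r₂ (trans (sym v∈C₁) (trans (sym (%-remove-+ʳ v gⱼ∣k)) v+k∈C₂))) ,
      [m+o]%n≡m%n⇒n∣o v k (g (suc j)) (begin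
        (v + k) % g (suc j)        ≡⟨ m∣n⇒o%n%m≡o%m (g (suc j)) (g j) (v + k) gⱼ₊₁∣gⱼ ⟨
        (v + k) % g j % g (suc j)  ≡⟨ cong (_% g (suc j)) v+k∈C₂ ⟩
        r₂ % g (suc j)             ≡⟨ same-parent ⟨
        r₁ % g (suc j)             ≡⟨ cong (_% g (suc j)) v∈C₁ ⟨
        v % g j % g (suc j)        ≡⟨ m∣n⇒o%n%m≡o%m (g (suc j)) (g j) v gⱼ₊₁∣gⱼ ⟩
        v % g (suc j)              ∎)
      where
      open ≡-Reasoning
      gⱼ₊₁∣gⱼ : g (suc j) ∣ g j
      gⱼ₊₁∣gⱼ = gseq-antitone (n≤1+n j)

    -- Only stripe φ(j+1) counts: stripes φ(1), …, φ(j) are multiples of g j, stripes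
    -- φ(j+2), …, φ(ℓ) are not multiples of g (suc j), and later stripes have weight 0.
    lengthWeight-crossing : ∀ {k} → ¬ g j ∣ k → g (suc j) ∣ k →
      lengthWeight k ≤ (if φ (suc j) ≡ᵇ k then wnum n φ ℓ (suc j) else 0)
    lengthWeight-crossing {k} gⱼ∤k gⱼ₊₁∣k = sumℕ-≤-indicator d (_≡ᵇ j) _ (λ _ _ → ≡ᵇ-unique j) term-≤
      where
      other-stripes-vanish : ∀ {t} → t ≢ j → φ (suc t) ≡ k → wnum n φ ℓ (suc t) ≡ 0
      other-stripes-vanish {t} t≢j φ≡k with <-cmp t j
      ... | tri< t<j _ _ = ⊥-elim (gⱼ∤k (subst (g j ∣_) φ≡k (gseq∣φ t<j)))
      ... | tri≈ _ t≡j _ = ⊥-elim (t≢j t≡j)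
      ... | tri> _ _ j<t with ℓ ≤? t
      ...   | yes ℓ≤t = wnum-≥ ℓ≤t
      ...   | no  ℓ≰t = ⊥-elim (gseq∤φ ell j<t (≰⇒> ℓ≰t) (subst (g (suc j) ∣_) (sym φ≡k) gⱼ₊₁∣k))
      term-≤ : ∀ {t} → t < d →
        (if φ (suc t) ≡ᵇ k then wnum n φ ℓ (suc t) else 0) ≤
        (if t ≡ᵇ j then (if φ (suc j) ≡ᵇ k then wnum n φ ℓ (suc j) else 0) else 0)
      term-≤ {t} _ with t ≡ᵇ j | ≡ᵇ-reflects t j
      ... | true  | ofʸ refl = ≤-refl
      ... | false | ofⁿ t≢j with φ (suc t) ≡ᵇ k | ≡ᵇ-reflects (φ (suc t)) k
      ...   | true  | ofʸ φ≡k = ≤-reflexive (other-stripes-vanish t≢j φ≡k)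
      ...   | false | _       = z≤n

    lengthWeight-from-to : ∀ {r₁ r₂ v k} → r₁ ≢ r₂ → r₁ % g (suc j) ≡ r₂ % g (suc j) →
      v % g j ≡ r₁ → (v + k) % g j ≡ r₂ →
      lengthWeight k ≤ (if φ (suc j) ≡ᵇ k then successorWeight r₁ r₂ else 0)
    lengthWeight-from-to {r₁} {r₂} {v} {k} r₁≢r₂ same-parent v∈C₁ v+k∈C₂ =
      ≤-trans (lengthWeight-crossing gⱼ∤k gⱼ₊₁∣k)
              (if-≤-if-if _ _ _ (λ φ≡k → ≡⇒≡ᵇ _ _ (lands (≡ᵇ⇒≡ _ _ φ≡k))))
      where
      open ≡-Reasoning
      gⱼ∤k : ¬ g j ∣ k
      gⱼ∤k = proj₁ (crossing-length r₁≢r₂ same-parent v∈C₁ v+k∈C₂)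
      gⱼ₊₁∣k : g (suc j) ∣ k
      gⱼ₊₁∣k = proj₂ (crossing-length r₁≢r₂ same-parent v∈C₁ v+k∈C₂)
      lands : φ (suc j) ≡ k → r₂ ≡ (r₁ + φ (suc j)) % g j
      lands φ≡k = begin
        r₂                      ≡⟨ v+k∈C₂ ⟨
        (v + k) % g j           ≡⟨ cong (λ x → (v + x) % g j) φ≡k ⟨
        (v + φ (suc j)) % g j   ≡⟨ m%n≡r⇒[m+o]%n≡[r+o]%n (φ (suc j)) (g j) v∈C₁ ⟩
        (r₁ + φ (suc j)) % g j  ∎

    flow-≤ : ∀ {r₁ r₂} → r₁ ≢ r₂ → r₁ % g (suc j) ≡ r₂ % g (suc j) →
      flow (resClass n φ j r₁) (resClass n φ j r₂) ≤ n / g j * successorWeight r₁ r₂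
    flow-≤ {r₁} {r₂} r₁≢r₂ same-parent = begin
      flow (resClass n φ j r₁) (resClass n φ j r₂)
        ≤⟨ sumℕ-mono-≤ n (λ {v} _ → out-≤ v) ⟩
      sumℕ n (λ v → class₁ (v % g j))
        ≡⟨ cong (λ m → sumℕ m (λ v → class₁ (v % g j))) (m/n*n≡m (gseq∣n j)) ⟨
      sumℕ (n / g j * g j) (λ v → class₁ (v % g j))
        ≡⟨ sumℕ-periodic (n / g j) (g j) class₁ ⟩
      n / g j * sumℕ (g j) class₁
        ≤⟨ *-monoʳ-≤ (n / g j) (sumℕ-≤-indicator (g j) (_≡ᵇ r₁) _ (λ _ _ → ≡ᵇ-unique r₁) (λ _ → ≤-refl)) ⟩
      n / g j * successorWeight r₁ r₂
        ∎
      where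
      open ≤-Reasoning
      class₁ : ℕ → ℕ
      class₁ u = if u ≡ᵇ r₁ then successorWeight r₁ r₂ else 0
      edge-≤ : ∀ {v} k → v % g j ≡ r₁ →
        (if (v + suc k) % n % g j ≡ᵇ r₂ then lengthWeight (suc k) else 0) ≤
        (if φ (suc j) ≡ᵇ suc k then successorWeight r₁ r₂ else 0)
      edge-≤ {v} k v∈C₁ with (v + suc k) % n % g j ≡ᵇ r₂ | ≡ᵇ-reflects ((v + suc k) % n % g j) r₂
      ... | false | _        = z≤n
      ... | true  | ofʸ w∈C₂ = lengthWeight-from-to r₁≢r₂ same-parent v∈C₁
                                  (trans (sym (m∣n⇒o%n%m≡o%m (g j) n (v + suc k) (gseq∣n j))) w∈C₂)
      out-≤ : ∀ v →
        sumℕ d (λ k → if (v % g j ≡ᵇ r₁) ∧ ((v + suc k) % n % g j ≡ᵇ r₂) then lengthWeight (suc k) else 0) ≤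
        class₁ (v % g j)
      out-≤ v with v % g j ≡ᵇ r₁ | ≡ᵇ-reflects (v % g j) r₁
      ... | false | _        = ≤-reflexive (sumℕ-zero d (λ _ → refl))
      ... | true  | ofʸ v∈C₁ = sumℕ-≤-indicator d (λ k → φ (suc j) ≡ᵇ suc k) _
        (λ _ _ p q → suc-injective (trans (sym (≡ᵇ⇒≡ (φ (suc j)) _ p)) (≡ᵇ⇒≡ (φ (suc j)) _ q)))
        (λ {k} _ → edge-≤ k v∈C₁)

    module Components (s : ℕ) (r : ℕ → ℕ)
      (r<gⱼ : ∀ i → i < s → r i < g j)
      (r-injective : ∀ i i' → i < s → i' < s → r i ≡ r i' → i ≡ i')
      (same-parent : ∀ i i' → i < s → i' < s → r i % g (suc j) ≡ r i' % g (suc j))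
      (s>0 : 0 < s) (s≤M : s ≤ g j / g (suc j)) (not-all : suc j < ℓ ⊎ s < g j / g (suc j)) where

      private
        K : ℕ
        K = n / g j * wnum n φ ℓ (suc j)

        isSuccessor : ℕ → ℕ → Bool
        isSuccessor i i' = r i' ≡ᵇ (r i + φ (suc j)) % g j

        successors : ℕ → ℕ
        successors i = sumℕ s (λ i' → if isSuccessor i i' then 1 else 0)

      flowTotal : ℕ
      flowTotal = sumℕ s (λ i₁ → sumℕ s (λ i₂ →
        if i₁ ≡ᵇ i₂ then 0 else flow (resClass n φ j (r i₁)) (resClass n φ j (r i₂))))

      flowTotal-≤ : flowTotal ≤ sumℕ s successors * K
      flowTotal-≤ = begin
        flowTotal
          ≤⟨ sumℕ-mono-≤ s (λ i₁<s → sumℕ-mono-≤ s (pair-≤ i₁<s)) ⟩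
        sumℕ s (λ i₁ → sumℕ s (λ i₂ → (if isSuccessor i₁ i₂ then 1 else 0) * K))
          ≡⟨ sumℕ-cong s (λ _ → sumℕ-*ʳ s _ K) ⟩
        sumℕ s (λ i₁ → successors i₁ * K)
          ≡⟨ sumℕ-*ʳ s successors K ⟩
        sumℕ s successors * K
          ∎
        where
        open ≤-Reasoning
        scale : ∀ b → n / g j * (if b then wnum n φ ℓ (suc j) else 0) ≡ (if b then 1 else 0) * K
        scale true  = sym (+-identityʳ K)
        scale false = *-zeroʳ (n / g j)
        pair-≤ : ∀ {i₁ i₂} → i₁ < s → i₂ < s →
          (if i₁ ≡ᵇ i₂ then 0 else flow (resClass n φ j (r i₁)) (resClass n φ j (r i₂))) ≤
          (if isSuccessor i₁ i₂ then 1 else 0) * K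
        pair-≤ {i₁} {i₂} i₁<s i₂<s with i₁ ≡ᵇ i₂ | ≡ᵇ-reflects i₁ i₂
        ... | true  | _         = z≤n
        ... | false | ofⁿ i₁≢i₂ =
          ≤-trans (flow-≤ (i₁≢i₂ ∘ r-injective i₁ i₂ i₁<s i₂<s) (same-parent i₁ i₂ i₁<s i₂<s))
                  (≤-reflexive (scale (isSuccessor i₁ i₂)))

      successors-≤1 : ∀ i → successors i ≤ 1
      successors-≤1 i = sumℕ-≤-indicator s (isSuccessor i) 1
        (λ i'<s i''<s p q → r-injective _ _ i'<s i''<s (≡ᵇ-unique _ p q)) (λ _ → ≤-refl)

      all-have-successors⇒M≤s : (∀ {i} → i < s → 0 < successors i) → g j / g (suc j) ≤ s
      all-have-successors⇒M≤s has-successor = +-closed⇒g/gcd[a,g]≤s (φ (suc j)) (g j) s r s>0 (r<gⱼ 0 s>0) successor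
        where
        successor : ∀ {i} → i < s → ∃[ i' ] i' < s × r i' ≡ (r i + φ (suc j)) % g j
        successor {i} i<s with ∃-positive-summand s (has-successor i<s)
        ... | i' , i'<s , hit = i' , i'<s , ≡ᵇ⇒≡ _ _ (if-positive⇒T (isSuccessor i i') 1 hit)

      flowTotal-≤-[s∸1]*n : flowTotal ≤ (s ∸ 1) * n
      flowTotal-≤-[s∸1]*n with sumℕ-<-or-positive s (λ {i} _ → successors-≤1 i)
      ... | inj₁ few = ≤-trans flowTotal-≤ (*-mono-≤ (∸-monoˡ-≤ 1 few) K≤n)
        where
        K≤n : K ≤ n
        K≤n = ≤-trans (*-monoʳ-≤ (n / g j) (wnum-≤ j)) (≤-reflexive (m/n*n≡m (gseq∣n j)))
      ... | inj₂ has-successor = ≤-trans flowTotal-≤ (≤-trans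
        (*-monoˡ-≤ K (sumℕ-≤-length s (λ {i} _ → successors-≤1 i))) (≤-reflexive s*K≡[s∸1]*n))
        where
        open ≡-Reasoning
        M≤s : g j / g (suc j) ≤ s
        M≤s = all-have-successors⇒M≤s has-successor
        s*gⱼ₊₁≡gⱼ : s * g (suc j) ≡ g j
        s*gⱼ₊₁≡gⱼ = trans (cong (_* g (suc j)) (≤-antisym s≤M M≤s)) (m/n*n≡m (gseq-antitone (n≤1+n j)))
        1+j<ℓ : suc j < ℓ
        1+j<ℓ = [ id , (λ s<M → ⊥-elim (<⇒≱ s<M M≤s)) ] not-all
        s*K≡[s∸1]*n : s * K ≡ (s ∸ 1) * n
        s*K≡[s∸1]*n = begin
          s * (n / g j * wnum n φ ℓ (suc j))
            ≡⟨ cong (λ w → s * (n / g j * w)) (wnum-< 1+j<ℓ) ⟩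
          s * (n / g j * (g j ∸ g (suc j)))
            ≡⟨ cong (λ x → s * (n / g j * (x ∸ g (suc j)))) s*gⱼ₊₁≡gⱼ ⟨
          s * (n / g j * (s * g (suc j) ∸ g (suc j)))
            ≡⟨ s*[c*[s*h∸h]]≡[s∸1]*[c*[s*h]] s (n / g j) (g (suc j)) ⟩
          (s ∸ 1) * (n / g j * (s * g (suc j)))
            ≡⟨ cong (λ x → (s ∸ 1) * (n / g j * x)) s*gⱼ₊₁≡gⱼ ⟩
          (s ∸ 1) * (n / g j * g j)
            ≡⟨ cong (λ x → (s ∸ 1) * x) (m/n*n≡m (gseq∣n j)) ⟩
          (s ∸ 1) * n
            ∎

xδ≡flow/n : ∀ m φ ℓ A B → xδ (suc m) φ ℓ A B ≡ (+ Circulant.flow (suc m) φ ℓ A B) /ℚ suc m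
xδ≡flow/n m φ ℓ A B =
  sumℚ-/suc m (suc m) _ λ {v} _ → sumℚ-/suc m (half (suc m)) _ λ {k} _ →
    if-/suc m (A v ∧ B ((v + suc k) % suc m)) _ 0 (xlen≡ (suc k)) (sym (ℚ.0/n≡0 (suc m)))
  where
  xlen≡ : ∀ k → xlen (suc m) φ ℓ k ≡ (+ Circulant.lengthWeight (suc m) φ ℓ k) /ℚ suc m
  xlen≡ k = sumℚ-/suc m (half (suc m)) _ λ {t} _ →
    if-/suc m (φ (suc t) ≡ᵇ k) _ 0 refl (sym (ℚ.0/n≡0 (suc m)))

lemma5 : (n : ℕ) .{{_ : NonZero n}} → 3 ≤ n →
  (c : ℕ → ℚ) (φ : ℕ → ℕ) → IsPermOf (half n) φ →
  (∀ i i' → 1 ≤ i → i ≤ i' → i' ≤ half n → c (φ i) ≤ℚ c (φ i')) →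
  (ℓ : ℕ) → IsEll n φ ℓ →
  (j : ℕ) → j < ℓ →
  (s : ℕ) (r : ℕ → ℕ) →
  (∀ i → i < s → r i < gseq n φ j) →
  (∀ i i' → i < s → i' < s → r i ≡ r i' → i ≡ i') →
  (∀ i i' → i < s → i' < s →
    modg n φ (suc j) (r i) ≡ modg n φ (suc j) (r i')) →
  1 < s → s ≤ gratio n φ j →
  (suc j < ℓ ⊎ s < gratio n φ j) →
  sumℚ s (λ i₁ → sumℚ s (λ i₂ →
    if i₁ ≡ᵇ i₂ then 0ℚ
    else xδ n φ ℓ (resClass n φ j (r i₁)) (resClass n φ j (r i₂))))
  ≤ℚ (+ (s ∸ 1)) /ℚ 1
lemma5 (suc m) _ _ φ _ _ ℓ ell j _ s r r<gⱼ r-injective same-parent 1<s s≤M not-all =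
  ℚ.≤-trans (ℚ.≤-reflexive as-fraction) (/suc-≤ m flowTotal (s ∸ 1) flowTotal-≤-[s∸1]*n)
  where
  open Circulant (suc m) φ ℓ
  open Level ell j
  open Components s r r<gⱼ r-injective same-parent (<-trans z<s 1<s) s≤M not-all
  as-fraction : sumℚ s (λ i₁ → sumℚ s (λ i₂ → if i₁ ≡ᵇ i₂ then 0ℚ
                  else xδ (suc m) φ ℓ (resClass (suc m) φ j (r i₁)) (resClass (suc m) φ j (r i₂))))
                ≡ (+ flowTotal) /ℚ suc m
  as-fraction = sumℚ-/suc m s _ λ {i₁} _ → sumℚ-/suc m s _ λ {i₂} _ →
    if-/suc m (i₁ ≡ᵇ i₂) 0 _ (sym (ℚ.0/n≡0 (suc m)))
      (xδ≡flow/n m φ ℓ (resClass (suc m) φ j (r i₁)) (resClass (suc m) φ j (r i₂)))
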